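{- Let $F:\mathcal{B}\to\mathcal{B}'$ be a left strong-exact functor between belian categories equipped with an ascent datum. Then every injective object $J$ of $\mathcal{B}$ is $F$-acyclic, i.e. $R^pF(J)=0$ for all $p>0$.
   Context: Belian category: balanced, pointed category with finite products, kernels, cokernels, in which every morphism with zero cokernel is epi. $f$ is strong if $\mathrm{coker}(\ker f)\to\ker(\mathrm{coker}f)$ is an isomorphism; a sequence is strong exact if exact (each $\mathrm{im}(d^{i-1})\to\ker(d^i)$ an isomorphism) with all maps strong; $H^i=\mathrm{coker}(\mathrm{im}\,d^{i-1}\to\ker d^i)$. Ascent functor $A:\mathcal{B}\to\mathcal{C}$ ($\mathcal{C}$ abelian): faithful, maps strong exact sequences to exact sequences, preserves epimorphisms. $F$ left strong-exact: preserves kernels and maps strong exact $0\to X\to Y\to Z$ to exact $0\to FX\to FY\to FZ$. Injective class $\mathcal{I}$: class of injective objects closed under finite products into which every object embeds. Ascent datum $(\mathcal{I},A,A',\tilde F)$: $A$ an ascent functor on $\mathcal{B}$ mapping members of $\mathcal{I}$ to injectives, $A'$ an ascent functor on $\mathcal{B}'$, $\tilde F$ a left exact functor between the abelian targets with $A'F\cong\tilde FA$ on $\mathcal{I}$. $R^pF(X)=H^p(F(I^\bullet))$ for a strong exact resolution $0\to X\to I^0\to I^1\to\cdots$ by members of $\mathcal{I}$. -}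

module Defs where

open import Level using (Level; _⊔_) renaming (suc to lsuc)
open import Data.Product using (Σ; _×_; _,_; Σ-syntax; proj₁; proj₂)
open import Data.Nat using (ℕ; zero; suc)
open import Relation.Binary using (Rel; IsEquivalence)

record Category (o ℓ e : Level) : Set (lsuc (o ⊔ ℓ ⊔ e)) where
  infixr 9 _∘_
  infix 4 _≈_
  field
    Obj : Set o
    _⇒_ : Obj → Obj → Set ℓ
    _≈_ : ∀ {A B} → Rel (A ⇒ B) e
    id : ∀ {A} → A ⇒ A
    _∘_ : ∀ {A B C} → B ⇒ C → A ⇒ B → A ⇒ C
    ≈-equiv : ∀ {A B} → IsEquivalence (_≈_ {A} {B})
    ∘-resp-≈ : ∀ {A B C} {f h : B ⇒ C} {g i : A ⇒ B} →
               f ≈ h → g ≈ i → f ∘ g ≈ h ∘ i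
    assoc : ∀ {A B C D} {f : A ⇒ B} {g : B ⇒ C} {h : C ⇒ D} →
            (h ∘ g) ∘ f ≈ h ∘ (g ∘ f)
    identityˡ : ∀ {A B} {f : A ⇒ B} → id ∘ f ≈ f
    identityʳ : ∀ {A B} {f : A ⇒ B} → f ∘ id ≈ f

record Functor {o ℓ e o' ℓ' e' : Level}
               (C : Category o ℓ e) (D : Category o' ℓ' e')
               : Set (o ⊔ ℓ ⊔ e ⊔ o' ⊔ ℓ' ⊔ e') where
  private
    module C = Category C
    module D = Category D
  field
    F₀ : C.Obj → D.Obj
    F₁ : ∀ {A B} → A C.⇒ B → F₀ A D.⇒ F₀ B
    identity : ∀ {A} → F₁ (C.id {A}) D.≈ D.id
    homomorphism : ∀ {A B E} {f : A C.⇒ B} {g : B C.⇒ E} →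
                   F₁ (g C.∘ f) D.≈ F₁ g D.∘ F₁ f
    F-resp-≈ : ∀ {A B} {f g : A C.⇒ B} → f C.≈ g → F₁ f D.≈ F₁ g

module _ {o ℓ e : Level} (C : Category o ℓ e) where
  open Category C

  Mono : ∀ {A B} → A ⇒ B → Set (o ⊔ ℓ ⊔ e)
  Mono {A} f = ∀ {X} (g h : X ⇒ A) → f ∘ g ≈ f ∘ h → g ≈ h

  Epi : ∀ {A B} → A ⇒ B → Set (o ⊔ ℓ ⊔ e)
  Epi {B = B} f = ∀ {X} (g h : B ⇒ X) → g ∘ f ≈ h ∘ f → g ≈ h

  IsIso : ∀ {A B} → A ⇒ B → Set (ℓ ⊔ e)
  IsIso {A} {B} f = Σ[ g ∈ B ⇒ A ] (g ∘ f ≈ id × f ∘ g ≈ id)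

  IsZeroObj : Obj → Set (o ⊔ ℓ ⊔ e)
  IsZeroObj Z = (∀ X → Σ[ f ∈ X ⇒ Z ] (∀ g → g ≈ f))
              × (∀ X → Σ[ f ∈ Z ⇒ X ] (∀ g → g ≈ f))

  IsProduct : ∀ {A B P} → P ⇒ A → P ⇒ B → Set (o ⊔ ℓ ⊔ e)
  IsProduct {A} {B} {P} π₁ π₂ =
    ∀ {W} (f : W ⇒ A) (g : W ⇒ B) →
      Σ[ u ∈ W ⇒ P ] ((π₁ ∘ u ≈ f × π₂ ∘ u ≈ g)
        × (∀ u' → π₁ ∘ u' ≈ f → π₂ ∘ u' ≈ g → u' ≈ u))

  record Product (A B : Obj) : Set (o ⊔ ℓ ⊔ e) where
    field
      obj : Obj
      π₁ : obj ⇒ A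
      π₂ : obj ⇒ B
      isProduct : IsProduct π₁ π₂

  Injective : Obj → Set (o ⊔ ℓ ⊔ e)
  Injective J = ∀ {X Y} (m : X ⇒ Y) → Mono m → (f : X ⇒ J) →
                Σ[ g ∈ Y ⇒ J ] (g ∘ m ≈ f)

  module _ (Z : Obj) (isZ : IsZeroObj Z) where

    0m : ∀ {A B} → A ⇒ B
    0m {A} {B} = proj₁ (proj₂ isZ B) ∘ proj₁ (proj₁ isZ A)

    IsKernel : ∀ {K A B} → A ⇒ B → K ⇒ A → Set (o ⊔ ℓ ⊔ e)
    IsKernel {K} {A} f k =
      (f ∘ k ≈ 0m)
      × (∀ {W} (h : W ⇒ A) → f ∘ h ≈ 0m →
           Σ[ u ∈ W ⇒ K ] (k ∘ u ≈ h × (∀ u' → k ∘ u' ≈ h → u' ≈ u)))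

    IsCokernel : ∀ {A B Q} → A ⇒ B → B ⇒ Q → Set (o ⊔ ℓ ⊔ e)
    IsCokernel {A} {B} {Q} f c =
      (c ∘ f ≈ 0m)
      × (∀ {W} (h : B ⇒ W) → h ∘ f ≈ 0m →
           Σ[ u ∈ Q ⇒ W ] (u ∘ c ≈ h × (∀ u' → u' ∘ c ≈ h → u' ≈ u)))

    record Kernel {A B} (f : A ⇒ B) : Set (o ⊔ ℓ ⊔ e) where
      field
        obj : Obj
        arr : obj ⇒ A
        isKernel : IsKernel f arr

    record Cokernel {A B} (f : A ⇒ B) : Set (o ⊔ ℓ ⊔ e) where
      field
        obj : Obj
        arr : B ⇒ obj
        isCokernel : IsCokernel f arr

record PreBelian (o ℓ e : Level) : Set (lsuc (o ⊔ ℓ ⊔ e)) where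
  field
    cat : Category o ℓ e
    𝟘 : Category.Obj cat
    𝟘-zero : IsZeroObj cat 𝟘
    product : ∀ A B → Product cat A B
    kernel : ∀ {A B} (f : Category._⇒_ cat A B) → Kernel cat 𝟘 𝟘-zero f
    cokernel : ∀ {A B} (f : Category._⇒_ cat A B) → Cokernel cat 𝟘 𝟘-zero f

module _ {o ℓ e : Level} (P : PreBelian o ℓ e) where
  open PreBelian P
  open Category cat

  ¡ : ∀ {X} → 𝟘 ⇒ X
  ¡ {X} = proj₁ (proj₂ 𝟘-zero X)

  ker-obj : ∀ {A B} → A ⇒ B → Obj
  ker-obj f = Kernel.obj (kernel f)
  ker-arr : ∀ {A B} (f : A ⇒ B) → ker-obj f ⇒ A
  ker-arr f = Kernel.arr (kernel f)
  coker-obj : ∀ {A B} → A ⇒ B → Obj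
  coker-obj f = Cokernel.obj (cokernel f)
  coker-arr : ∀ {A B} (f : A ⇒ B) → B ⇒ coker-obj f
  coker-arr f = Cokernel.arr (cokernel f)

  im-obj : ∀ {A B} → A ⇒ B → Obj
  im-obj f = ker-obj (coker-arr f)
  im-arr : ∀ {A B} (f : A ⇒ B) → im-obj f ⇒ B
  im-arr f = ker-arr (coker-arr f)

  Strong : ∀ {A B} → A ⇒ B → Set (ℓ ⊔ e)
  Strong f = Σ[ φ ∈ coker-obj (ker-arr f) ⇒ ker-obj (coker-arr f) ]
               ((ker-arr (coker-arr f) ∘ (φ ∘ coker-arr (ker-arr f)) ≈ f)
                × IsIso cat φ)

  Exact : ∀ {X Y Z} → X ⇒ Y → Y ⇒ Z → Set (ℓ ⊔ e)
  Exact f g = Σ[ φ ∈ im-obj f ⇒ ker-obj g ]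
                ((ker-arr g ∘ φ ≈ im-arr f) × IsIso cat φ)

  StrongExact : ∀ {X Y Z} → X ⇒ Y → Y ⇒ Z → Set (ℓ ⊔ e)
  StrongExact f g = Strong f × Strong g × Exact f g

  -- the cohomology H = coker(im f → ker g) at Y is zero
  CohomologyVanishes : ∀ {X Y Z} → X ⇒ Y → Y ⇒ Z → Set (o ⊔ ℓ ⊔ e)
  CohomologyVanishes f g =
    Σ[ φ ∈ im-obj f ⇒ ker-obj g ]
      ((ker-arr g ∘ φ ≈ im-arr f) × IsZeroObj cat (coker-obj φ))

record Belian (o ℓ e : Level) : Set (lsuc (o ⊔ ℓ ⊔ e)) where
  field
    pre : PreBelian o ℓ e
  open PreBelian pre public
  open Category cat
  field
    balanced : ∀ {A B} (f : A ⇒ B) → Mono cat f → Epi cat f → IsIso cat f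
    zeroCoker⇒epi : ∀ {A B} (f : A ⇒ B) →
                    IsZeroObj cat (coker-obj pre f) → Epi cat f

-- Freyd's definition: zero object, binary products, kernels, cokernels,
-- every mono is a kernel and every epi is a cokernel.
record Abelian (o ℓ e : Level) : Set (lsuc (o ⊔ ℓ ⊔ e)) where
  field
    pre : PreBelian o ℓ e
  open PreBelian pre public
  open Category cat
  field
    mono-normal : ∀ {A B} (m : A ⇒ B) → Mono cat m →
                  Σ[ C ∈ Obj ] Σ[ g ∈ B ⇒ C ] IsKernel cat 𝟘 𝟘-zero g m
    epi-normal : ∀ {A B} (p : A ⇒ B) → Epi cat p →
                 Σ[ C ∈ Obj ] Σ[ g ∈ C ⇒ A ] IsCokernel cat 𝟘 𝟘-zero g p

module _ {o ℓ e o' ℓ' e' : Level} where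

  PreservesKernels : (P : PreBelian o ℓ e) (Q : PreBelian o' ℓ' e') →
    Functor (PreBelian.cat P) (PreBelian.cat Q) → Set (o ⊔ ℓ ⊔ e ⊔ o' ⊔ ℓ' ⊔ e')
  PreservesKernels P Q F =
    ∀ {K A B} (f : A ⇒ B) (k : K ⇒ A) →
      IsKernel (PreBelian.cat P) (PreBelian.𝟘 P) (PreBelian.𝟘-zero P) f k →
      IsKernel (PreBelian.cat Q) (PreBelian.𝟘 Q) (PreBelian.𝟘-zero Q) (F₁ f) (F₁ k)
    where open Category (PreBelian.cat P)
          open Functor F

  record AscentFunctor (B : Belian o ℓ e) (C : Abelian o' ℓ' e')
         : Set (o ⊔ ℓ ⊔ e ⊔ o' ⊔ ℓ' ⊔ e') where
    private
      module B = Belian B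
      module C = Abelian C
      module BC = Category B.cat
      module CC = Category C.cat
    field
      functor : Functor B.cat C.cat
    open Functor functor
    field
      faithful : ∀ {X Y} (f g : X BC.⇒ Y) → F₁ f CC.≈ F₁ g → f BC.≈ g
      strongExact⇒exact : ∀ {X Y Z} (f : X BC.⇒ Y) (g : Y BC.⇒ Z) →
        StrongExact B.pre f g → Exact C.pre (F₁ f) (F₁ g)
      preservesEpi : ∀ {X Y} (f : X BC.⇒ Y) → Epi B.cat f → Epi C.cat (F₁ f)

  record LeftStrongExact (B : Belian o ℓ e) (B' : Belian o' ℓ' e')
         (F : Functor (Belian.cat B) (Belian.cat B'))
         : Set (o ⊔ ℓ ⊔ e ⊔ o' ⊔ ℓ' ⊔ e') where
    private
      module B = Belian B
      module B' = Belian B'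
      module BC = Category B.cat
    open Functor F
    field
      preservesKernels : PreservesKernels B.pre B'.pre F
      leftExact : ∀ {X Y Z} (f : X BC.⇒ Y) (g : Y BC.⇒ Z) →
        StrongExact B.pre (¡ B.pre {X}) f → StrongExact B.pre f g →
        Exact B'.pre (¡ B'.pre {F₀ X}) (F₁ f) × Exact B'.pre (F₁ f) (F₁ g)

  record LeftExact (C : Abelian o ℓ e) (C' : Abelian o' ℓ' e')
         (F : Functor (Abelian.cat C) (Abelian.cat C'))
         : Set (o ⊔ ℓ ⊔ e ⊔ o' ⊔ ℓ' ⊔ e') where
    private
      module C = Abelian C
      module C' = Abelian C'
    open Functor F
    field
      preservesZero : IsZeroObj C'.cat (F₀ C.𝟘)
      preservesProducts : ∀ A B →
        IsProduct C'.cat (F₁ (Product.π₁ (C.product A B)))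
                         (F₁ (Product.π₂ (C.product A B)))
      preservesKernels : PreservesKernels C.pre C'.pre F

record InjectiveClass {o ℓ e : Level} (B : Belian o ℓ e) (i : Level)
       : Set (o ⊔ ℓ ⊔ e ⊔ lsuc i) where
  private
    module B = Belian B
  open Category B.cat
  field
    member : Obj → Set i
    member-injective : ∀ X → member X → Injective B.cat X
    member-𝟘 : member B.𝟘
    member-product : ∀ X Y → member X → member Y →
                     member (Product.obj (B.product X Y))
    embed : ∀ X → Σ[ I ∈ Obj ] (member I × Σ[ m ∈ X ⇒ I ] Mono B.cat m)

record AscentDatum {o₁ ℓ₁ e₁ o₂ ℓ₂ e₂ o₃ ℓ₃ e₃ o₄ ℓ₄ e₄ : Level} (i : Level)
       (B : Belian o₁ ℓ₁ e₁) (B' : Belian o₂ ℓ₂ e₂)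
       (C : Abelian o₃ ℓ₃ e₃) (C' : Abelian o₄ ℓ₄ e₄)
       (F : Functor (Belian.cat B) (Belian.cat B'))
       : Set (o₁ ⊔ ℓ₁ ⊔ e₁ ⊔ o₂ ⊔ ℓ₂ ⊔ e₂ ⊔ o₃ ⊔ ℓ₃ ⊔ e₃ ⊔ o₄ ⊔ ℓ₄ ⊔ e₄ ⊔ lsuc i) where
  private
    module B = Belian B
    module BC = Category B.cat
    module C = Abelian C
    module C' = Abelian C'
    module C'C = Category C'.cat
    module F = Functor F
  field
    𝓘 : InjectiveClass B i
    A : AscentFunctor B C
    A' : AscentFunctor B' C'
    F̃ : Functor C.cat C'.cat
    F̃-leftExact : LeftExact C C' F̃
  private
    module 𝓘 = InjectiveClass 𝓘
    module A = Functor (AscentFunctor.functor A)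
    module A' = Functor (AscentFunctor.functor A')
    module F̃ = Functor F̃
  field
    A-injective : ∀ X → 𝓘.member X → Injective C.cat (A.F₀ X)
    -- natural isomorphism A' ∘ F ≅ F̃ ∘ A on the full subcategory 𝓘
    α : ∀ X → 𝓘.member X → A'.F₀ (F.F₀ X) C'C.⇒ F̃.F₀ (A.F₀ X)
    α-iso : ∀ X (p : 𝓘.member X) → IsIso C'.cat (α X p)
    α-natural : ∀ X Y (p : 𝓘.member X) (q : 𝓘.member Y) (h : X BC.⇒ Y) →
      α Y q C'C.∘ A'.F₁ (F.F₁ h) C'C.≈ F̃.F₁ (A.F₁ h) C'C.∘ α X p

record Resolution {o ℓ e i : Level} (B : Belian o ℓ e)
       (member : Category.Obj (Belian.cat B) → Set i)
       (X : Category.Obj (Belian.cat B)) : Set (o ⊔ ℓ ⊔ e ⊔ i) where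
  private
    module B = Belian B
  open Category B.cat
  field
    I : ℕ → Obj
    I-member : ∀ n → member (I n)
    ε : X ⇒ I 0
    d : ∀ n → I n ⇒ I (suc n)
    strong-¡ : Strong B.pre (¡ B.pre {X})
    strong-ε : Strong B.pre ε
    strong-d : ∀ n → Strong B.pre (d n)
    exact-X : Exact B.pre (¡ B.pre {X}) ε
    exact-0 : Exact B.pre ε (d 0)
    exact-suc : ∀ n → Exact B.pre (d n) (d (suc n))

{-# OPTIONS --safe #-}
module Submission where

-- Since J is injective, the strong monomorphism ε : J → I⁰ splits, so the ascent functor A turns
-- the resolution into an exact complex of injectives A J → A I⁰ → A I¹ → ⋯ beginning with a split
-- mono. Inductively every cycle object of such a complex is injective, hence each differential
-- corestricts to a split epimorphism onto the next cycle object: the complex is split exact.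
-- Split exactness survives the left exact F̃, hence, through A′F ≅ F̃A on 𝓘, it holds for A′(F I•).
-- There it forces A′ of the canonical map im(F dⁿ) → ker(F dⁿ⁺¹) to be a split epimorphism; A′ is
-- faithful, so that map is epi and its cokernel Hⁿ⁺¹(F I•) = Rⁿ⁺¹F(J) vanishes.

open import Level using (Level; _⊔_)
open import Data.Nat using (ℕ; zero; suc)
open import Data.Product using (_×_; _,_; Σ-syntax; proj₁; proj₂)
open import Relation.Binary using (Setoid; IsEquivalence)
import Relation.Binary.Reasoning.Setoid as SetoidReasoning
open import Defs

module CategoryProperties {o ℓ e : Level} (𝒞 : Category o ℓ e) where
  open Category 𝒞 public

  module ≈ {A B} = IsEquivalence (≈-equiv {A} {B})

  hom-setoid : Obj → Obj → Setoid ℓ e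
  hom-setoid A B = record { isEquivalence = ≈-equiv {A} {B} }

  open module HomReasoning {A B} = SetoidReasoning (hom-setoid A B) public

  infixr 4 _⟩∘⟨_ refl⟩∘⟨_
  infixl 5 _⟩∘⟨refl

  _⟩∘⟨_ : ∀ {A B C} {f h : B ⇒ C} {g i : A ⇒ B} → f ≈ h → g ≈ i → f ∘ g ≈ h ∘ i
  _⟩∘⟨_ = ∘-resp-≈

  refl⟩∘⟨_ : ∀ {A B C} {f : B ⇒ C} {g i : A ⇒ B} → g ≈ i → f ∘ g ≈ f ∘ i
  refl⟩∘⟨ p = ≈.refl ⟩∘⟨ p

  _⟩∘⟨refl : ∀ {A B C} {f h : B ⇒ C} {g : A ⇒ B} → f ≈ h → f ∘ g ≈ h ∘ g
  p ⟩∘⟨refl = p ⟩∘⟨ ≈.refl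

  sym-assoc : ∀ {A B C D} {f : A ⇒ B} {g : B ⇒ C} {h : C ⇒ D} → h ∘ (g ∘ f) ≈ (h ∘ g) ∘ f
  sym-assoc = ≈.sym assoc

  pullˡ : ∀ {A B C D} {a : B ⇒ C} {b : A ⇒ B} {c : A ⇒ C} {f : D ⇒ A} →
          a ∘ b ≈ c → a ∘ (b ∘ f) ≈ c ∘ f
  pullˡ p = ≈.trans sym-assoc (p ⟩∘⟨refl)

  pullʳ : ∀ {A B C D} {a : B ⇒ C} {b : A ⇒ B} {c : A ⇒ C} {f : C ⇒ D} →
          a ∘ b ≈ c → (f ∘ a) ∘ b ≈ f ∘ c
  pullʳ p = ≈.trans assoc (refl⟩∘⟨ p)

  cancelˡ : ∀ {A B C} {h : B ⇒ A} {i : A ⇒ B} {f : C ⇒ A} → h ∘ i ≈ id → h ∘ (i ∘ f) ≈ f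
  cancelˡ p = ≈.trans (pullˡ p) identityˡ

  cancelʳ : ∀ {A B C} {h : B ⇒ A} {i : A ⇒ B} {f : A ⇒ C} → h ∘ i ≈ id → (f ∘ h) ∘ i ≈ f
  cancelʳ p = ≈.trans (pullʳ p) identityʳ

  SplitEpi : ∀ {A B} → A ⇒ B → Set (ℓ ⊔ e)
  SplitEpi {A} {B} f = Σ[ s ∈ B ⇒ A ] (f ∘ s ≈ id)

  retraction⇒mono : ∀ {A B} {f : A ⇒ B} (r : B ⇒ A) → r ∘ f ≈ id → Mono 𝒞 f
  retraction⇒mono {f = f} r rf≈id g h fg≈fh = begin
    g           ≈⟨ cancelˡ rf≈id ⟨
    r ∘ (f ∘ g) ≈⟨ refl⟩∘⟨ fg≈fh ⟩
    r ∘ (f ∘ h) ≈⟨ cancelˡ rf≈id ⟩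
    h           ∎

  section⇒epi : ∀ {A B} {f : A ⇒ B} (s : B ⇒ A) → f ∘ s ≈ id → Epi 𝒞 f
  section⇒epi {f = f} s fs≈id g h gf≈hf = begin
    g           ≈⟨ cancelʳ fs≈id ⟨
    (g ∘ f) ∘ s ≈⟨ gf≈hf ⟩∘⟨refl ⟩
    (h ∘ f) ∘ s ≈⟨ cancelʳ fs≈id ⟩
    h           ∎

  iso⇒mono : ∀ {A B} {f : A ⇒ B} → IsIso 𝒞 f → Mono 𝒞 f
  iso⇒mono (g , gf≈id , _) = retraction⇒mono g gf≈id

  iso⇒epi : ∀ {A B} {f : A ⇒ B} → IsIso 𝒞 f → Epi 𝒞 f
  iso⇒epi (g , _ , fg≈id) = section⇒epi g fg≈id

  section-of-mono⇒retraction : ∀ {A B} {f : A ⇒ B} {s : B ⇒ A} →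
    Mono 𝒞 f → f ∘ s ≈ id → s ∘ f ≈ id
  section-of-mono⇒retraction {f = f} {s} mono fs≈id =
    mono (s ∘ f) id (≈.trans (pullˡ fs≈id) (≈.trans identityˡ (≈.sym identityʳ)))

  retraction-of-epi⇒section : ∀ {A B} {f : A ⇒ B} {r : B ⇒ A} →
    Epi 𝒞 f → r ∘ f ≈ id → f ∘ r ≈ id
  retraction-of-epi⇒section {f = f} {r} epi rf≈id =
    epi (f ∘ r) id (≈.trans (pullʳ rf≈id) (≈.trans identityʳ (≈.sym identityˡ)))

  mono-∘ : ∀ {A B C} {g : B ⇒ C} {f : A ⇒ B} → Mono 𝒞 g → Mono 𝒞 f → Mono 𝒞 (g ∘ f)
  mono-∘ {f = f} g-mono f-mono x y gfx≈gfy =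
    f-mono x y (g-mono (f ∘ x) (f ∘ y) (≈.trans sym-assoc (≈.trans gfx≈gfy assoc)))

  mono-∘-cancel : ∀ {A B C} {g : B ⇒ C} {f : A ⇒ B} → Mono 𝒞 (g ∘ f) → Mono 𝒞 f
  mono-∘-cancel gf-mono x y fx≈fy =
    gf-mono x y (≈.trans assoc (≈.trans (refl⟩∘⟨ fx≈fy) sym-assoc))

  epi-∘ : ∀ {A B C} {g : B ⇒ C} {f : A ⇒ B} → Epi 𝒞 g → Epi 𝒞 f → Epi 𝒞 (g ∘ f)
  epi-∘ {g = g} g-epi f-epi x y xgf≈ygf =
    g-epi x y (f-epi (x ∘ g) (y ∘ g) (≈.trans assoc (≈.trans xgf≈ygf sym-assoc)))

  mono-resp-≈ : ∀ {A B} {f g : A ⇒ B} → f ≈ g → Mono 𝒞 f → Mono 𝒞 g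
  mono-resp-≈ f≈g f-mono x y gx≈gy =
    f-mono x y (≈.trans (f≈g ⟩∘⟨refl) (≈.trans gx≈gy (≈.sym f≈g ⟩∘⟨refl)))

  epi-resp-≈ : ∀ {A B} {f g : A ⇒ B} → f ≈ g → Epi 𝒞 f → Epi 𝒞 g
  epi-resp-≈ f≈g f-epi x y xg≈yg =
    f-epi x y (≈.trans (refl⟩∘⟨ f≈g) (≈.trans xg≈yg (refl⟩∘⟨ ≈.sym f≈g)))

  iso-∘ : ∀ {A B C} {g : B ⇒ C} {f : A ⇒ B} → IsIso 𝒞 g → IsIso 𝒞 f → IsIso 𝒞 (g ∘ f)
  iso-∘ (g⁻¹ , g⁻¹g≈id , gg⁻¹≈id) (f⁻¹ , f⁻¹f≈id , ff⁻¹≈id) =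
      f⁻¹ ∘ g⁻¹
    , ≈.trans assoc (≈.trans (refl⟩∘⟨ cancelˡ g⁻¹g≈id) f⁻¹f≈id)
    , ≈.trans assoc (≈.trans (refl⟩∘⟨ cancelˡ ff⁻¹≈id) gg⁻¹≈id)

  retract-injective : ∀ {X Y} (s : Y ⇒ X) (r : X ⇒ Y) → r ∘ s ≈ id →
    Injective 𝒞 X → Injective 𝒞 Y
  retract-injective s r rs≈id X-injective m m-mono f =
    let (g , gm≈sf) = X-injective m m-mono (s ∘ f)
    in r ∘ g , ≈.trans (pullʳ gm≈sf) (cancelˡ rs≈id)

Faithful : ∀ {o ℓ e o′ ℓ′ e′} {𝒞 : Category o ℓ e} {𝒟 : Category o′ ℓ′ e′} →
  Functor 𝒞 𝒟 → Set (o ⊔ ℓ ⊔ e ⊔ e′)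
Faithful {𝒞 = 𝒞} {𝒟} G =
  ∀ {X Y} (f g : X 𝒞.⇒ Y) → Functor.F₁ G f 𝒟.≈ Functor.F₁ G g → f 𝒞.≈ g
  where module 𝒞 = Category 𝒞
        module 𝒟 = Category 𝒟

faithful-reflects-epi : ∀ {o ℓ e o′ ℓ′ e′} {𝒞 : Category o ℓ e} {𝒟 : Category o′ ℓ′ e′}
  (G : Functor 𝒞 𝒟) → Faithful G →
  ∀ {A B} {f : Category._⇒_ 𝒞 A B} → Epi 𝒟 (Functor.F₁ G f) → Epi 𝒞 f
faithful-reflects-epi {𝒟 = 𝒟} G faithful G₁f-epi x y xf≈yf =
  faithful x y (G₁f-epi (F₁ x) (F₁ y)
    (𝒟.≈.trans (𝒟.≈.sym homomorphism) (𝒟.≈.trans (F-resp-≈ xf≈yf) homomorphism)))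
  where open Functor G
        module 𝒟 = CategoryProperties 𝒟

module PointedProperties {o ℓ e : Level} (P : PreBelian o ℓ e) where
  open PreBelian P using (𝟘; 𝟘-zero; kernel; cokernel)
  open PreBelian P using (cat) public
  open CategoryProperties cat public

  0ₘ : ∀ {A B} → A ⇒ B
  0ₘ = 0m cat 𝟘 𝟘-zero

  IsKer : ∀ {K A B} → A ⇒ B → K ⇒ A → Set (o ⊔ ℓ ⊔ e)
  IsKer = IsKernel cat 𝟘 𝟘-zero

  IsCoker : ∀ {A B Q} → A ⇒ B → B ⇒ Q → Set (o ⊔ ℓ ⊔ e)
  IsCoker = IsCokernel cat 𝟘 𝟘-zero

  ! : ∀ {X} → X ⇒ 𝟘
  ! {X} = proj₁ (proj₁ 𝟘-zero X)

  from-zero-obj-unique : ∀ {Z Y} → IsZeroObj cat Z → (f g : Z ⇒ Y) → f ≈ g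
  from-zero-obj-unique {Y = Y} Z-zero f g =
    ≈.trans (proj₂ (proj₂ Z-zero Y) f) (≈.sym (proj₂ (proj₂ Z-zero Y) g))

  to-zero-obj-unique : ∀ {Z X} → IsZeroObj cat Z → (f g : X ⇒ Z) → f ≈ g
  to-zero-obj-unique {X = X} Z-zero f g =
    ≈.trans (proj₂ (proj₁ Z-zero X) f) (≈.sym (proj₂ (proj₁ Z-zero X) g))

  0ₘ-absorbˡ : ∀ {A B C} {f : A ⇒ B} → 0ₘ {B} {C} ∘ f ≈ 0ₘ
  0ₘ-absorbˡ {f = f} = ≈.trans assoc (refl⟩∘⟨ to-zero-obj-unique 𝟘-zero (! ∘ f) !)

  0ₘ-absorbʳ : ∀ {A B C} {f : B ⇒ C} → f ∘ 0ₘ {A} {B} ≈ 0ₘ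
  0ₘ-absorbʳ {f = f} = ≈.trans sym-assoc (from-zero-obj-unique 𝟘-zero (f ∘ ¡ P) (¡ P) ⟩∘⟨refl)

  id≈0ₘ⇒zero-obj : ∀ {X} → id {X} ≈ 0ₘ → IsZeroObj cat X
  id≈0ₘ⇒zero-obj id≈0 =
      (λ W → 0ₘ , λ g → ≈.trans (≈.sym identityˡ) (≈.trans (id≈0 ⟩∘⟨refl) 0ₘ-absorbˡ))
    , (λ W → 0ₘ , λ g → ≈.trans (≈.sym identityʳ) (≈.trans (refl⟩∘⟨ id≈0) 0ₘ-absorbʳ))

  mono∧≈0ₘ⇒zero-obj : ∀ {A B} {k : A ⇒ B} → Mono cat k → k ≈ 0ₘ → IsZeroObj cat A
  mono∧≈0ₘ⇒zero-obj k-mono k≈0 =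
    id≈0ₘ⇒zero-obj (k-mono id 0ₘ (≈.trans identityʳ (≈.trans k≈0 (≈.sym 0ₘ-absorbʳ))))

  epi∧≈0ₘ⇒zero-obj : ∀ {A B} {c : A ⇒ B} → Epi cat c → c ≈ 0ₘ → IsZeroObj cat B
  epi∧≈0ₘ⇒zero-obj c-epi c≈0 =
    id≈0ₘ⇒zero-obj (c-epi id 0ₘ (≈.trans identityˡ (≈.trans c≈0 (≈.sym 0ₘ-absorbˡ))))

  between-zero-objs-iso : ∀ {A B} → IsZeroObj cat A → IsZeroObj cat B → (f : A ⇒ B) → IsIso cat f
  between-zero-objs-iso A-zero B-zero f =
    0ₘ , from-zero-obj-unique A-zero (0ₘ ∘ f) id , from-zero-obj-unique B-zero (f ∘ 0ₘ) id

  zero-obj-injective : ∀ {Z} → IsZeroObj cat Z → Injective cat Z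
  zero-obj-injective Z-zero m _ f = 0ₘ , to-zero-obj-unique Z-zero (0ₘ ∘ m) f

  ker-isKernel : ∀ {A B} (f : A ⇒ B) → IsKer f (ker-arr P f)
  ker-isKernel f = Kernel.isKernel (kernel f)

  coker-isCokernel : ∀ {A B} (f : A ⇒ B) → IsCoker f (coker-arr P f)
  coker-isCokernel f = Cokernel.isCokernel (cokernel f)

  factor-through-kernel : ∀ {K A B W} {g : A ⇒ B} {k : K ⇒ A} → IsKer g k →
    {h : W ⇒ A} → g ∘ h ≈ 0ₘ → Σ[ u ∈ W ⇒ K ] (k ∘ u ≈ h)
  factor-through-kernel (_ , universal) {h} gh≈0 =
    let (u , ku≈h , _) = universal h gh≈0 in u , ku≈h

  factor-through-cokernel : ∀ {A B Q W} {f : A ⇒ B} {c : B ⇒ Q} → IsCoker f c →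
    {h : B ⇒ W} → h ∘ f ≈ 0ₘ → Σ[ u ∈ Q ⇒ W ] (u ∘ c ≈ h)
  factor-through-cokernel (_ , universal) {h} hf≈0 =
    let (u , uc≈h , _) = universal h hf≈0 in u , uc≈h

  kernel⇒mono : ∀ {K A B} {g : A ⇒ B} {k : K ⇒ A} → IsKer g k → Mono cat k
  kernel⇒mono {k = k} (gk≈0 , universal) x y kx≈ky =
    let (_ , _ , unique) = universal (k ∘ y) (≈.trans (pullˡ gk≈0) 0ₘ-absorbˡ)
    in ≈.trans (unique x kx≈ky) (≈.sym (unique y ≈.refl))

  cokernel⇒epi : ∀ {A B Q} {f : A ⇒ B} {c : B ⇒ Q} → IsCoker f c → Epi cat c
  cokernel⇒epi {c = c} (cf≈0 , universal) x y xc≈yc =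
    let (_ , _ , unique) = universal (y ∘ c) (≈.trans (pullʳ cf≈0) 0ₘ-absorbʳ)
    in ≈.trans (unique x xc≈yc) (≈.sym (unique y ≈.refl))

  kernel-of-0ₘ-iso : ∀ {K A B} {g : A ⇒ B} {k : K ⇒ A} → IsKer g k → g ≈ 0ₘ → IsIso cat k
  kernel-of-0ₘ-iso k-isKer g≈0 =
    let (u , ku≈id) = factor-through-kernel k-isKer (≈.trans identityʳ g≈0)
    in u , section-of-mono⇒retraction (kernel⇒mono k-isKer) ku≈id , ku≈id

  cokernel-of-0ₘ-iso : ∀ {A B Q} {f : A ⇒ B} {c : B ⇒ Q} → IsCoker f c → f ≈ 0ₘ → IsIso cat c
  cokernel-of-0ₘ-iso c-isCoker f≈0 =
    let (u , uc≈id) = factor-through-cokernel c-isCoker (≈.trans identityˡ f≈0)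
    in u , uc≈id , retraction-of-epi⇒section (cokernel⇒epi c-isCoker) uc≈id

  kernel-of-mono≈0ₘ : ∀ {K A B} {g : A ⇒ B} {k : K ⇒ A} → Mono cat g → IsKer g k → k ≈ 0ₘ
  kernel-of-mono≈0ₘ g-mono (gk≈0 , _) = g-mono _ 0ₘ (≈.trans gk≈0 (≈.sym 0ₘ-absorbʳ))

  kernel-cancel-mono : ∀ {K A B C} {n : B ⇒ C} {p : A ⇒ B} {f : A ⇒ C} {k : K ⇒ A} →
    Mono cat n → n ∘ p ≈ f → IsKer f k → IsKer p k
  kernel-cancel-mono {p = p} {k = k} n-mono np≈f (fk≈0 , universal) =
      n-mono (p ∘ k) 0ₘ (≈.trans (pullˡ np≈f) (≈.trans fk≈0 (≈.sym 0ₘ-absorbʳ)))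
    , λ h ph≈0 → universal h (≈.trans (≈.sym np≈f ⟩∘⟨refl) (≈.trans (pullʳ ph≈0) 0ₘ-absorbʳ))

  epi⇒zero-cokernel : ∀ {A B} {f : A ⇒ B} → Epi cat f → IsZeroObj cat (coker-obj P f)
  epi⇒zero-cokernel {f = f} f-epi =
    let (cf≈0 , _) = coker-isCokernel f
    in epi∧≈0ₘ⇒zero-obj (cokernel⇒epi (coker-isCokernel f))
                        (f-epi (coker-arr P f) 0ₘ (≈.trans cf≈0 (≈.sym 0ₘ-absorbˡ)))

  im-factor : ∀ {A B} (f : A ⇒ B) → Σ[ q ∈ A ⇒ im-obj P f ] (im-arr P f ∘ q ≈ f)
  im-factor f = factor-through-kernel (ker-isKernel (coker-arr P f)) (proj₁ (coker-isCokernel f))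

  ∘-im-arr≈0ₘ : ∀ {A B C} {f : A ⇒ B} {g : B ⇒ C} → g ∘ f ≈ 0ₘ → g ∘ im-arr P f ≈ 0ₘ
  ∘-im-arr≈0ₘ {f = f} {g} gf≈0 =
    let (w , wc≈g) = factor-through-cokernel (coker-isCokernel f) gf≈0 in begin
      g ∘ im-arr P f                   ≈⟨ wc≈g ⟩∘⟨refl ⟨
      (w ∘ coker-arr P f) ∘ im-arr P f ≈⟨ pullʳ (proj₁ (ker-isKernel (coker-arr P f))) ⟩
      w ∘ 0ₘ                           ≈⟨ 0ₘ-absorbʳ ⟩
      0ₘ                               ∎

  image-to-kernel : ∀ {A B C} {f : A ⇒ B} {g : B ⇒ C} → g ∘ f ≈ 0ₘ →
    Σ[ φ ∈ im-obj P f ⇒ ker-obj P g ] (ker-arr P g ∘ φ ≈ im-arr P f)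
  image-to-kernel {g = g} gf≈0 = factor-through-kernel (ker-isKernel g) (∘-im-arr≈0ₘ gf≈0)

  im-arr-of-0ₘ : ∀ {A B} {f : A ⇒ B} → f ≈ 0ₘ → im-arr P f ≈ 0ₘ
  im-arr-of-0ₘ {f = f} f≈0 =
    kernel-of-mono≈0ₘ (iso⇒mono (cokernel-of-0ₘ-iso (coker-isCokernel f) f≈0))
                      (ker-isKernel (coker-arr P f))

  im-factor-of-kernel-iso : ∀ {K A B} {g : A ⇒ B} {k : K ⇒ A} {q : K ⇒ im-obj P k} →
    IsKer g k → im-arr P k ∘ q ≈ k → IsIso cat q
  im-factor-of-kernel-iso {k = k} {q} k-isKer iq≈k =
    let (t , kt≈i) = factor-through-kernel k-isKer (∘-im-arr≈0ₘ (proj₁ k-isKer))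
    in t
     , kernel⇒mono k-isKer (t ∘ q) id (≈.trans (pullˡ kt≈i) (≈.trans iq≈k (≈.sym identityʳ)))
     , kernel⇒mono (ker-isKernel (coker-arr P k)) (q ∘ t) id
         (≈.trans (pullˡ iq≈k) (≈.trans kt≈i (≈.sym identityʳ)))

  exact⇒∘≈0ₘ : ∀ {A B C} {f : A ⇒ B} {g : B ⇒ C} → Exact P f g → g ∘ f ≈ 0ₘ
  exact⇒∘≈0ₘ {f = f} {g} (φ , κφ≈i , _) = let (q , iq≈f) = im-factor f in begin
    g ∘ f                         ≈⟨ refl⟩∘⟨ iq≈f ⟨
    g ∘ (im-arr P f ∘ q)          ≈⟨ refl⟩∘⟨ (κφ≈i ⟩∘⟨refl) ⟨
    g ∘ ((ker-arr P g ∘ φ) ∘ q)   ≈⟨ refl⟩∘⟨ assoc ⟩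
    g ∘ (ker-arr P g ∘ (φ ∘ q))   ≈⟨ pullˡ (proj₁ (ker-isKernel g)) ⟩
    0ₘ ∘ (φ ∘ q)                  ≈⟨ 0ₘ-absorbˡ ⟩
    0ₘ                            ∎

  exact-into-mono⇒≈0ₘ : ∀ {A B C} {f : A ⇒ B} {g : B ⇒ C} → Exact P f g → Mono cat g → f ≈ 0ₘ
  exact-into-mono⇒≈0ₘ {f = f} {g} (φ , κφ≈i , _) g-mono = let (q , iq≈f) = im-factor f in begin
    f                       ≈⟨ iq≈f ⟨
    im-arr P f ∘ q          ≈⟨ κφ≈i ⟩∘⟨refl ⟨
    (ker-arr P g ∘ φ) ∘ q   ≈⟨ (kernel-of-mono≈0ₘ g-mono (ker-isKernel g) ⟩∘⟨refl) ⟩∘⟨refl ⟩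
    (0ₘ ∘ φ) ∘ q            ≈⟨ ≈.trans (0ₘ-absorbˡ ⟩∘⟨refl) 0ₘ-absorbˡ ⟩
    0ₘ                      ∎

  exact-after-0ₘ⇒ker-arr≈0ₘ : ∀ {A B C} {f : A ⇒ B} {g : B ⇒ C} →
    f ≈ 0ₘ → Exact P f g → ker-arr P g ≈ 0ₘ
  exact-after-0ₘ⇒ker-arr≈0ₘ {f = f} {g} f≈0 (φ , κφ≈i , (φ⁻¹ , _ , φφ⁻¹≈id)) = begin
    ker-arr P g               ≈⟨ identityʳ ⟨
    ker-arr P g ∘ id          ≈⟨ refl⟩∘⟨ φφ⁻¹≈id ⟨
    ker-arr P g ∘ (φ ∘ φ⁻¹)   ≈⟨ pullˡ κφ≈i ⟩
    im-arr P f ∘ φ⁻¹          ≈⟨ im-arr-of-0ₘ f≈0 ⟩∘⟨refl ⟩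
    0ₘ ∘ φ⁻¹                  ≈⟨ 0ₘ-absorbˡ ⟩
    0ₘ                        ∎

  ker-arr≈0ₘ⇒kernel-trivial : ∀ {A B W} {g : A ⇒ B} {h : W ⇒ A} →
    ker-arr P g ≈ 0ₘ → g ∘ h ≈ 0ₘ → h ≈ 0ₘ
  ker-arr≈0ₘ⇒kernel-trivial {g = g} κ≈0 gh≈0 =
    let (u , κu≈h) = factor-through-kernel (ker-isKernel g) gh≈0
    in ≈.trans (≈.sym κu≈h) (≈.trans (κ≈0 ⟩∘⟨refl) 0ₘ-absorbˡ)

  strong∧ker-arr≈0ₘ⇒mono : ∀ {A B} {f : A ⇒ B} → Strong P f → ker-arr P f ≈ 0ₘ → Mono cat f
  strong∧ker-arr≈0ₘ⇒mono {f = f} (ψ , iψp≈f , ψ-iso) κ≈0 =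
    mono-resp-≈ iψp≈f
      (mono-∘ (kernel⇒mono (ker-isKernel (coker-arr P f)))
        (mono-∘ (iso⇒mono ψ-iso)
          (iso⇒mono (cokernel-of-0ₘ-iso (coker-isCokernel (ker-arr P f)) κ≈0))))

  kernel⇒strong : ∀ {K A B} {g : A ⇒ B} {k : K ⇒ A} → IsKer g k → Strong P k
  kernel⇒strong {k = k} k-isKer =
    let (q , iq≈k) = im-factor k
        (p⁻¹ , p⁻¹p≈id , pp⁻¹≈id) =
          cokernel-of-0ₘ-iso (coker-isCokernel (ker-arr P k))
                             (kernel-of-mono≈0ₘ (kernel⇒mono k-isKer) (ker-isKernel k))
    in q ∘ p⁻¹
     , ≈.trans (refl⟩∘⟨ cancelʳ p⁻¹p≈id) iq≈k
     , iso-∘ (im-factor-of-kernel-iso k-isKer iq≈k) (coker-arr P (ker-arr P k) , pp⁻¹≈id , p⁻¹p≈id)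

  ¡-isKernel : ∀ {X} → IsKer (id {X}) (¡ P)
  ¡-isKernel =
      ≈.trans identityˡ (from-zero-obj-unique 𝟘-zero (¡ P) 0ₘ)
    , λ h id∘h≈0 →
        0ₘ , ≈.trans 0ₘ-absorbʳ (≈.sym (≈.trans (≈.sym identityˡ) id∘h≈0))
           , λ u _ → to-zero-obj-unique 𝟘-zero u 0ₘ

  id-isKernel-of-! : ∀ {X} → IsKer (! {X}) id
  id-isKernel-of-! =
      to-zero-obj-unique 𝟘-zero (! ∘ id) 0ₘ
    , λ h _ → h , identityˡ , λ u idu≈h → ≈.trans (≈.sym identityˡ) idu≈h

  exact-¡-mono : ∀ {X Y} {g : X ⇒ Y} → Mono cat g → Exact P (¡ P) g
  exact-¡-mono {X} {g = g} g-mono =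
    let im-zero : IsZeroObj cat (im-obj P (¡ P {X}))
        im-zero = mono∧≈0ₘ⇒zero-obj (kernel⇒mono (ker-isKernel (coker-arr P (¡ P {X}))))
                                    (im-arr-of-0ₘ (from-zero-obj-unique 𝟘-zero (¡ P) 0ₘ))
        ker-zero : IsZeroObj cat (ker-obj P g)
        ker-zero = mono∧≈0ₘ⇒zero-obj (kernel⇒mono (ker-isKernel g))
                                     (kernel-of-mono≈0ₘ g-mono (ker-isKernel g))
    in 0ₘ , from-zero-obj-unique im-zero _ _ , between-zero-objs-iso im-zero ker-zero 0ₘ

  kernel⇒strongExact : ∀ {K A B} {g : A ⇒ B} {k : K ⇒ A} → IsKer g k → StrongExact P (¡ P) k
  kernel⇒strongExact k-isKer =
    kernel⇒strong ¡-isKernel , kernel⇒strong k-isKer , exact-¡-mono (kernel⇒mono k-isKer)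

  -- Unlike exactness, this is preserved by every kernel-preserving functor.
  SplitExact : ∀ {X Y Z} → X ⇒ Y → Y ⇒ Z → Set (o ⊔ ℓ ⊔ e)
  SplitExact {X} {Y} d g =
    Σ[ K ∈ Obj ] Σ[ κ ∈ K ⇒ Y ] Σ[ p ∈ X ⇒ K ] (IsKer g κ × κ ∘ p ≈ d × SplitEpi p)

  SplitExact⇒factor-split-epi : ∀ {X Y Z M} {d : X ⇒ Y} {g : Y ⇒ Z} {m : M ⇒ Y} {p : X ⇒ M} →
    SplitExact d g → Mono cat m → g ∘ m ≈ 0ₘ → m ∘ p ≈ d → SplitEpi p
  SplitExact⇒factor-split-epi {d = d} {m = m} {p}
    (_ , κ , e , κ-isKer , κe≈d , (s , es≈id)) m-mono gm≈0 mp≈d =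
    let (τ , κτ≈m) = factor-through-kernel κ-isKer gm≈0
        τp≈e : τ ∘ p ≈ e
        τp≈e = kernel⇒mono κ-isKer (τ ∘ p) e (begin
          κ ∘ (τ ∘ p) ≈⟨ pullˡ κτ≈m ⟩
          m ∘ p       ≈⟨ mp≈d ⟩
          d           ≈⟨ κe≈d ⟨
          κ ∘ e       ∎)
        τ-mono : Mono cat τ
        τ-mono = mono-∘-cancel (mono-resp-≈ (≈.sym κτ≈m) m-mono)
    in s ∘ τ , ≈.trans sym-assoc (section-of-mono⇒retraction τ-mono (≈.trans (pullˡ τp≈e) es≈id))

  kernel-transport : ∀ {K Y Z Y′ Z′} {g : Y ⇒ Z} {g′ : Y′ ⇒ Z′} {κ : K ⇒ Y′}
    {a₁ : Y ⇒ Y′} {a₂ : Z ⇒ Z′} → IsIso cat a₁ → Mono cat a₂ → a₂ ∘ g ≈ g′ ∘ a₁ →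
    IsKer g′ κ → Σ[ κ₀ ∈ K ⇒ Y ] (IsKer g κ₀ × a₁ ∘ κ₀ ≈ κ)
  kernel-transport {K} {Y} {g = g} {g′} {κ} {a₁} {a₂}
    (a₁⁻¹ , a₁⁻¹a₁≈id , a₁a₁⁻¹≈id) a₂-mono a₂g≈g′a₁ (g′κ≈0 , universal) =
    a₁⁻¹ ∘ κ , (gκ₀≈0 , universal₀) , cancelˡ a₁a₁⁻¹≈id
    where
    gκ₀≈0 : g ∘ (a₁⁻¹ ∘ κ) ≈ 0ₘ
    gκ₀≈0 = a₂-mono (g ∘ (a₁⁻¹ ∘ κ)) 0ₘ (begin
      a₂ ∘ (g ∘ (a₁⁻¹ ∘ κ))    ≈⟨ pullˡ a₂g≈g′a₁ ⟩
      (g′ ∘ a₁) ∘ (a₁⁻¹ ∘ κ)  ≈⟨ pullʳ (cancelˡ a₁a₁⁻¹≈id) ⟩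
      g′ ∘ κ                  ≈⟨ g′κ≈0 ⟩
      0ₘ                      ≈⟨ 0ₘ-absorbʳ ⟨
      a₂ ∘ 0ₘ                 ∎)
    universal₀ : ∀ {W} (h : W ⇒ Y) → g ∘ h ≈ 0ₘ →
      Σ[ u ∈ W ⇒ K ] ((a₁⁻¹ ∘ κ) ∘ u ≈ h × (∀ u′ → (a₁⁻¹ ∘ κ) ∘ u′ ≈ h → u′ ≈ u))
    universal₀ h gh≈0 =
      let g′a₁h≈0 : g′ ∘ (a₁ ∘ h) ≈ 0ₘ
          g′a₁h≈0 = begin
            g′ ∘ (a₁ ∘ h)   ≈⟨ sym-assoc ⟩
            (g′ ∘ a₁) ∘ h   ≈⟨ a₂g≈g′a₁ ⟩∘⟨refl ⟨
            (a₂ ∘ g) ∘ h    ≈⟨ pullʳ gh≈0 ⟩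
            a₂ ∘ 0ₘ         ≈⟨ 0ₘ-absorbʳ ⟩
            0ₘ              ∎
          (u , κu≈a₁h , unique) = universal (a₁ ∘ h) g′a₁h≈0
      in u
       , ≈.trans (pullʳ κu≈a₁h) (cancelˡ a₁⁻¹a₁≈id)
       , λ u′ κ₀u′≈h → unique u′ (≈.trans (≈.sym (cancelˡ a₁a₁⁻¹≈id))
                                          (≈.trans (refl⟩∘⟨ sym-assoc) (refl⟩∘⟨ κ₀u′≈h)))

  SplitExact-transport : ∀ {X Y Z X′ Y′ Z′} {d : X ⇒ Y} {g : Y ⇒ Z} {d′ : X′ ⇒ Y′} {g′ : Y′ ⇒ Z′}
    {a₀ : X ⇒ X′} {a₁ : Y ⇒ Y′} {a₂ : Z ⇒ Z′} →
    IsIso cat a₀ → IsIso cat a₁ → Mono cat a₂ → a₁ ∘ d ≈ d′ ∘ a₀ → a₂ ∘ g ≈ g′ ∘ a₁ →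
    SplitExact d′ g′ → SplitExact d g
  SplitExact-transport {d = d} {d′ = d′} {a₀ = a₀} {a₁}
    (a₀⁻¹ , _ , a₀a₀⁻¹≈id) a₁-iso a₂-mono a₁d≈d′a₀ a₂g≈g′a₁
    (K , κ , p , κ-isKer , κp≈d′ , (s , ps≈id)) =
    let (κ₀ , κ₀-isKer , a₁κ₀≈κ) = kernel-transport a₁-iso a₂-mono a₂g≈g′a₁ κ-isKer
    in K , κ₀ , p ∘ a₀ , κ₀-isKer
     , iso⇒mono a₁-iso (κ₀ ∘ (p ∘ a₀)) d (begin
         a₁ ∘ (κ₀ ∘ (p ∘ a₀)) ≈⟨ pullˡ a₁κ₀≈κ ⟩
         κ ∘ (p ∘ a₀)         ≈⟨ pullˡ κp≈d′ ⟩
         d′ ∘ a₀              ≈⟨ a₁d≈d′a₀ ⟨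
         a₁ ∘ d               ∎)
     , (a₀⁻¹ ∘ s , ≈.trans assoc (≈.trans (refl⟩∘⟨ cancelˡ a₀a₀⁻¹≈id) ps≈id))

module PointedFunctorProperties {o ℓ e o′ ℓ′ e′ : Level}
  (P : PreBelian o ℓ e) (Q : PreBelian o′ ℓ′ e′)
  (F : Functor (PreBelian.cat P) (PreBelian.cat Q)) where
  private
    module P = PointedProperties P
    module Q = PointedProperties Q
  open Functor F

  Preserves0ₘ : Set (o ⊔ e′)
  Preserves0ₘ = ∀ {X Y} → F₁ (P.0ₘ {X} {Y}) Q.≈ Q.0ₘ

  F₁-¡≈0ₘ⇒preserves-0ₘ : (∀ {X} → F₁ (¡ P {X}) Q.≈ Q.0ₘ) → Preserves0ₘ
  F₁-¡≈0ₘ⇒preserves-0ₘ F₁¡≈0 = Q.≈.trans homomorphism (Q.≈.trans (F₁¡≈0 Q.⟩∘⟨refl) Q.0ₘ-absorbˡ)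

  preserves-kernels⇒preserves-0ₘ : PreservesKernels P Q F → Preserves0ₘ
  preserves-kernels⇒preserves-0ₘ preserves = F₁-¡≈0ₘ⇒preserves-0ₘ (Q.≈.trans
    (Q.≈.trans (Q.≈.sym Q.identityˡ) (Q.≈.sym identity Q.⟩∘⟨refl))
    (proj₁ (preserves P.id (¡ P) P.¡-isKernel)))

  preserves-0ₘ⇒∘≈0ₘ : Preserves0ₘ → ∀ {A B C} {f : A P.⇒ B} {g : B P.⇒ C} →
    g P.∘ f P.≈ P.0ₘ → F₁ g Q.∘ F₁ f Q.≈ Q.0ₘ
  preserves-0ₘ⇒∘≈0ₘ preserves-0 gf≈0 =
    Q.≈.trans (Q.≈.sym homomorphism) (Q.≈.trans (F-resp-≈ gf≈0) preserves-0)

  preserves-kernels⇒preserves-SplitExact : PreservesKernels P Q F →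
    ∀ {X Y Z} {d : X P.⇒ Y} {g : Y P.⇒ Z} → P.SplitExact d g → Q.SplitExact (F₁ d) (F₁ g)
  preserves-kernels⇒preserves-SplitExact preserves (K , κ , p , κ-isKer , κp≈d , (s , ps≈id)) =
      F₀ K , F₁ κ , F₁ p , preserves _ κ κ-isKer
    , Q.≈.trans (Q.≈.sym homomorphism) (F-resp-≈ κp≈d)
    , (F₁ s , Q.≈.trans (Q.≈.sym homomorphism) (Q.≈.trans (F-resp-≈ ps≈id) identity))

module AbelianProperties {o ℓ e : Level} (𝒜 : Abelian o ℓ e) where
  open Abelian 𝒜 using (pre; product; mono-normal; epi-normal)
  open PointedProperties pre public

  record Equalizer {A W : Obj} (u v : A ⇒ W) : Set (o ⊔ ℓ ⊔ e) where
    field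
      obj : Obj
      arr : obj ⇒ A
      arr-mono : Mono cat arr
      equalizes : u ∘ arr ≈ v ∘ arr
      factor : ∀ {X} {h : X ⇒ A} → u ∘ h ≈ v ∘ h → Σ[ s ∈ X ⇒ obj ] (arr ∘ s ≈ h)

  equalizer : ∀ {A W} (u v : A ⇒ W) → Equalizer u v
  equalizer {A} {W} u v = record
    { obj = ker-obj pre (H ∘ ⟨ u , v ⟩)
    ; arr = k
    ; arr-mono = kernel⇒mono (ker-isKernel (H ∘ ⟨ u , v ⟩))
    ; equalizes = ≈.trans (project π₁∘⟨⟩ π₁∘⟨⟩) (≈.sym (project π₂∘⟨⟩ π₂∘⟨⟩))
    ; factor = factor
    }
    where
    open Product (product W W) using (obj; π₁; π₂; isProduct)

    ⟨_,_⟩ : ∀ {X} → X ⇒ W → X ⇒ W → X ⇒ obj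
    ⟨ f , g ⟩ = proj₁ (isProduct f g)

    π₁∘⟨⟩ : ∀ {X} {f g : X ⇒ W} → π₁ ∘ ⟨ f , g ⟩ ≈ f
    π₁∘⟨⟩ {f = f} {g} = proj₁ (proj₁ (proj₂ (isProduct f g)))

    π₂∘⟨⟩ : ∀ {X} {f g : X ⇒ W} → π₂ ∘ ⟨ f , g ⟩ ≈ g
    π₂∘⟨⟩ {f = f} {g} = proj₂ (proj₁ (proj₂ (isProduct f g)))

    product-ext : ∀ {X} {f g : X ⇒ obj} → π₁ ∘ f ≈ π₁ ∘ g → π₂ ∘ f ≈ π₂ ∘ g → f ≈ g
    product-ext {f = f} {g} π₁f≈π₁g π₂f≈π₂g =
      let (_ , _ , unique) = isProduct (π₁ ∘ f) (π₂ ∘ f)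
      in ≈.trans (unique f ≈.refl ≈.refl) (≈.sym (unique g (≈.sym π₁f≈π₁g) (≈.sym π₂f≈π₂g)))

    Δ : W ⇒ obj
    Δ = ⟨ id , id ⟩

    Δ-mono : Mono cat Δ
    Δ-mono = retraction⇒mono π₁ π₁∘⟨⟩

    H-obj : Obj
    H-obj = proj₁ (mono-normal Δ Δ-mono)

    H : obj ⇒ H-obj
    H = proj₁ (proj₂ (mono-normal Δ Δ-mono))

    H-isKer : IsKer H Δ
    H-isKer = proj₂ (proj₂ (mono-normal Δ Δ-mono))

    k : ker-obj pre (H ∘ ⟨ u , v ⟩) ⇒ A
    k = ker-arr pre (H ∘ ⟨ u , v ⟩)

    H⟨u,v⟩k≈0 : H ∘ (⟨ u , v ⟩ ∘ k) ≈ 0ₘ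
    H⟨u,v⟩k≈0 = ≈.trans sym-assoc (proj₁ (ker-isKernel (H ∘ ⟨ u , v ⟩)))

    c : ker-obj pre (H ∘ ⟨ u , v ⟩) ⇒ W
    c = proj₁ (factor-through-kernel H-isKer H⟨u,v⟩k≈0)

    Δc≈⟨u,v⟩k : Δ ∘ c ≈ ⟨ u , v ⟩ ∘ k
    Δc≈⟨u,v⟩k = proj₂ (factor-through-kernel H-isKer H⟨u,v⟩k≈0)

    project : ∀ {π : obj ⇒ W} {x : A ⇒ W} → π ∘ ⟨ u , v ⟩ ≈ x → π ∘ Δ ≈ id → x ∘ k ≈ c
    project {π} {x} π⟨u,v⟩≈x πΔ≈id = begin
      x ∘ k                  ≈⟨ π⟨u,v⟩≈x ⟩∘⟨refl ⟨
      (π ∘ ⟨ u , v ⟩) ∘ k     ≈⟨ assoc ⟩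
      π ∘ (⟨ u , v ⟩ ∘ k)     ≈⟨ refl⟩∘⟨ Δc≈⟨u,v⟩k ⟨
      π ∘ (Δ ∘ c)            ≈⟨ cancelˡ πΔ≈id ⟩
      c                      ∎

    factor : ∀ {X} {h : X ⇒ A} → u ∘ h ≈ v ∘ h → Σ[ s ∈ X ⇒ ker-obj pre (H ∘ ⟨ u , v ⟩) ] (k ∘ s ≈ h)
    factor {h = h} uh≈vh =
      let ⟨u,v⟩h≈Δuh : ⟨ u , v ⟩ ∘ h ≈ Δ ∘ (u ∘ h)
          ⟨u,v⟩h≈Δuh = product-ext
            (≈.trans (pullˡ π₁∘⟨⟩) (≈.sym (cancelˡ π₁∘⟨⟩)))
            (≈.trans (pullˡ π₂∘⟨⟩) (≈.trans (≈.sym uh≈vh) (≈.sym (cancelˡ π₂∘⟨⟩))))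
      in factor-through-kernel (ker-isKernel (H ∘ ⟨ u , v ⟩)) (begin
           (H ∘ ⟨ u , v ⟩) ∘ h  ≈⟨ pullʳ ⟨u,v⟩h≈Δuh ⟩
           H ∘ (Δ ∘ (u ∘ h))    ≈⟨ pullˡ (proj₁ H-isKer) ⟩
           0ₘ ∘ (u ∘ h)         ≈⟨ 0ₘ-absorbˡ ⟩
           0ₘ                   ∎)

  image-minimal : ∀ {A B C E} {f : A ⇒ B} {g : B ⇒ C} {k : E ⇒ im-obj pre f} {s : A ⇒ E} →
    IsKer g (im-arr pre f ∘ k) → (im-arr pre f ∘ k) ∘ s ≈ f → SplitEpi k
  image-minimal {f = f} {g} {k} ik-isKer iks≈f =
    let gf≈0 : g ∘ f ≈ 0ₘ
        gf≈0 = ≈.trans (refl⟩∘⟨ ≈.sym iks≈f) (≈.trans (pullˡ (proj₁ ik-isKer)) 0ₘ-absorbˡ)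
        (t , ikt≈i) = factor-through-kernel ik-isKer (∘-im-arr≈0ₘ gf≈0)
    in t , kernel⇒mono (ker-isKernel (coker-arr pre f)) (k ∘ t) id
             (≈.trans sym-assoc (≈.trans ikt≈i (≈.sym identityʳ)))

  im-factor-epi : ∀ {A B} {f : A ⇒ B} {q : A ⇒ im-obj pre f} → im-arr pre f ∘ q ≈ f → Epi cat q
  im-factor-epi {f = f} iq≈f u v uq≈vq = begin
      u            ≈⟨ ≈.trans (refl⟩∘⟨ kt≈id) identityʳ ⟨
      u ∘ (k ∘ t)  ≈⟨ ≈.trans sym-assoc (≈.trans (equalizes ⟩∘⟨refl) assoc) ⟩
      v ∘ (k ∘ t)  ≈⟨ ≈.trans (refl⟩∘⟨ kt≈id) identityʳ ⟩
      v            ∎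
    where
    open Equalizer (equalizer u v) renaming (arr to k)

    ik-mono : Mono cat (im-arr pre f ∘ k)
    ik-mono = mono-∘ (kernel⇒mono (ker-isKernel (coker-arr pre f))) arr-mono

    k-split : SplitEpi k
    k-split = image-minimal (proj₂ (proj₂ (mono-normal (im-arr pre f ∘ k) ik-mono)))
                (≈.trans assoc (≈.trans (refl⟩∘⟨ proj₂ (factor uq≈vq)) iq≈f))

    t : im-obj pre f ⇒ obj
    t = proj₁ k-split

    kt≈id : k ∘ t ≈ id
    kt≈id = proj₂ k-split

  balanced : ∀ {A B} {m : A ⇒ B} → Mono cat m → Epi cat m → IsIso cat m
  balanced {m = m} m-mono m-epi =
    let (_ , g , m-isKer) = mono-normal m m-mono
    in kernel-of-0ₘ-iso m-isKer (m-epi g 0ₘ (≈.trans (proj₁ m-isKer) (≈.sym 0ₘ-absorbˡ)))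

  trivial-kernel⇒mono : ∀ {A B} {f : A ⇒ B} →
    (∀ {W} {h : W ⇒ A} → f ∘ h ≈ 0ₘ → h ≈ 0ₘ) → Mono cat f
  trivial-kernel⇒mono {f = f} trivial =
    let (q , iq≈f) = im-factor f
        (_ , g , q-isCoker) = epi-normal q (im-factor-epi iq≈f)
        g≈0 : g ≈ 0ₘ
        g≈0 = trivial (≈.trans (≈.sym iq≈f ⟩∘⟨refl) (≈.trans (pullʳ (proj₁ q-isCoker)) 0ₘ-absorbʳ))
    in mono-resp-≈ iq≈f (mono-∘ (kernel⇒mono (ker-isKernel _))
                                (iso⇒mono (cokernel-of-0ₘ-iso q-isCoker g≈0)))

  zero-cokernel⇒epi : ∀ {A B} {f : A ⇒ B} → coker-arr pre f ≈ 0ₘ → Epi cat f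
  zero-cokernel⇒epi {f = f} c≈0 =
    let (q , iq≈f) = im-factor f
    in epi-resp-≈ iq≈f (epi-∘ (iso⇒epi (kernel-of-0ₘ-iso (ker-isKernel (coker-arr pre f)) c≈0))
                              (im-factor-epi iq≈f))

  epi-factor : ∀ {N M W} {r : N ⇒ M} {h : N ⇒ W} → Epi cat r → h ∘ ker-arr pre r ≈ 0ₘ →
    Σ[ w ∈ M ⇒ W ] (w ∘ r ≈ h)
  epi-factor {r = r} r-epi hκ≈0 =
    let (_ , g , r-isCoker) = epi-normal r r-epi
        (y , κy≈g) = factor-through-kernel (ker-isKernel r) (proj₁ r-isCoker)
    in factor-through-cokernel r-isCoker
         (≈.trans (refl⟩∘⟨ ≈.sym κy≈g) (≈.trans (pullˡ hκ≈0) 0ₘ-absorbˡ))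

  exact⇒kernel-factor-epi : ∀ {A B C} {f : A ⇒ B} {g : B ⇒ C} {p : A ⇒ ker-obj pre g} →
    Exact pre f g → ker-arr pre g ∘ p ≈ f → Epi cat p
  exact⇒kernel-factor-epi {f = f} {g} {p} (φ , κφ≈i , φ-iso) κp≈f =
    let (q , iq≈f) = im-factor f
        p≈φq : p ≈ φ ∘ q
        p≈φq = kernel⇒mono (ker-isKernel g) p (φ ∘ q)
                 (≈.trans κp≈f (≈.trans (≈.sym iq≈f) (≈.trans (≈.sym κφ≈i ⟩∘⟨refl) assoc)))
    in epi-resp-≈ (≈.sym p≈φq) (epi-∘ (iso⇒epi φ-iso) (im-factor-epi iq≈f))

  split-mono-kernel⇒split-epi : ∀ {M N Q} {κ : M ⇒ N} {e : N ⇒ Q} {r : N ⇒ M} →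
    IsKer e κ → Epi cat e → r ∘ κ ≈ id → SplitEpi e
  split-mono-kernel⇒split-epi {N = N} {Q} {κ} {e} {r} κ-isKer e-epi rκ≈id =
    let (t⁻¹ , _ , tt⁻¹≈id) = balanced t-mono t-epi
    in j ∘ t⁻¹ , ≈.trans sym-assoc tt⁻¹≈id
    where
    j : ker-obj pre r ⇒ N
    j = ker-arr pre r

    t : ker-obj pre r ⇒ Q
    t = e ∘ j

    t-mono : Mono cat t
    t-mono = trivial-kernel⇒mono λ {_} {h} th≈0 →
      let (x , κx≈jh) = factor-through-kernel κ-isKer (≈.trans sym-assoc th≈0)
          x≈0 : x ≈ 0ₘ
          x≈0 = begin
            x             ≈⟨ cancelˡ rκ≈id ⟨
            r ∘ (κ ∘ x)   ≈⟨ refl⟩∘⟨ κx≈jh ⟩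
            r ∘ (j ∘ h)   ≈⟨ pullˡ (proj₁ (ker-isKernel r)) ⟩
            0ₘ ∘ h        ≈⟨ 0ₘ-absorbˡ ⟩
            0ₘ            ∎
      in kernel⇒mono (ker-isKernel r) h 0ₘ
           (≈.trans (≈.sym κx≈jh) (≈.trans (refl⟩∘⟨ x≈0) (≈.trans 0ₘ-absorbʳ (≈.sym 0ₘ-absorbʳ))))

    t-epi : Epi cat t
    t-epi =
      let c : Q ⇒ coker-obj pre t
          c = coker-arr pre t
          (w , wr≈ce) = epi-factor (section⇒epi κ rκ≈id) (≈.trans assoc (proj₁ (coker-isCokernel t)))
          w≈0 : w ≈ 0ₘ
          w≈0 = begin
            w             ≈⟨ ≈.trans (refl⟩∘⟨ rκ≈id) identityʳ ⟨
            w ∘ (r ∘ κ)   ≈⟨ pullˡ wr≈ce ⟩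
            (c ∘ e) ∘ κ   ≈⟨ pullʳ (proj₁ κ-isKer) ⟩
            c ∘ 0ₘ        ≈⟨ 0ₘ-absorbʳ ⟩
            0ₘ            ∎
      in zero-cokernel⇒epi (e-epi c 0ₘ
           (≈.trans (≈.sym wr≈ce) (≈.trans (w≈0 ⟩∘⟨refl) (≈.trans 0ₘ-absorbˡ (≈.sym 0ₘ-absorbˡ)))))

  exact-injective-complex-splits : (N : ℕ → Obj) (δ : ∀ m → N m ⇒ N (suc m)) →
    (∀ m → Exact pre (δ m) (δ (suc m))) → (∀ m → Injective cat (N m)) → Mono cat (δ 0) →
    ∀ m → SplitExact (δ m) (δ (suc m))
  exact-injective-complex-splits N δ exact injective δ₀-mono m =
      ker-obj pre (δ (suc m)) , ker-arr pre (δ (suc m)) , corestrict m , ker-isKernel (δ (suc m))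
    , κ∘corestrict≈δ m , corestrict-split m (K-injective m)
    where
    corestrict : ∀ m → N m ⇒ ker-obj pre (δ (suc m))
    corestrict m = proj₁ (factor-through-kernel (ker-isKernel (δ (suc m))) (exact⇒∘≈0ₘ (exact m)))

    κ∘corestrict≈δ : ∀ m → ker-arr pre (δ (suc m)) ∘ corestrict m ≈ δ m
    κ∘corestrict≈δ m = proj₂ (factor-through-kernel (ker-isKernel (δ (suc m))) (exact⇒∘≈0ₘ (exact m)))

    corestrict-split : ∀ m → Injective cat (ker-obj pre (δ m)) → SplitEpi (corestrict m)
    corestrict-split m K-injective =
      let (r , rκ≈id) = K-injective (ker-arr pre (δ m)) (kernel⇒mono (ker-isKernel (δ m))) id
          κ-isKer : IsKer (corestrict m) (ker-arr pre (δ m))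
          κ-isKer = kernel-cancel-mono (kernel⇒mono (ker-isKernel (δ (suc m)))) (κ∘corestrict≈δ m)
                                       (ker-isKernel (δ m))
      in split-mono-kernel⇒split-epi κ-isKer
           (exact⇒kernel-factor-epi (exact m) (κ∘corestrict≈δ m)) rκ≈id

    K-injective : ∀ m → Injective cat (ker-obj pre (δ m))
    K-injective zero = zero-obj-injective
      (mono∧≈0ₘ⇒zero-obj (kernel⇒mono (ker-isKernel (δ 0))) (kernel-of-mono≈0ₘ δ₀-mono (ker-isKernel (δ 0))))
    K-injective (suc m) = let (s , es≈id) = corestrict-split m (K-injective m)
                          in retract-injective s (corestrict m) es≈id (injective m)

module AscentFunctorProperties {o ℓ e o′ ℓ′ e′ : Level} {ℬ : Belian o ℓ e} {𝒜 : Abelian o′ ℓ′ e′}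
  (Asc : AscentFunctor ℬ 𝒜) where
  private
    module B = PointedProperties (Belian.pre ℬ)
    module A = AbelianProperties 𝒜
  open AscentFunctor Asc
  open Functor functor
  open PointedFunctorProperties (Belian.pre ℬ) (Abelian.pre 𝒜) functor public

  F₁-¡≈0ₘ : ∀ {X} → F₁ (¡ (Belian.pre ℬ) {X}) A.≈ A.0ₘ
  F₁-¡≈0ₘ {X} = A.exact-into-mono⇒≈0ₘ
    (strongExact⇒exact (¡ (Belian.pre ℬ)) B.id (B.kernel⇒strongExact (B.id-isKernel-of-! {X})))
    (A.mono-resp-≈ (A.≈.sym identity) (A.retraction⇒mono A.id A.identityˡ))

  preserves-0ₘ : Preserves0ₘ
  preserves-0ₘ = F₁-¡≈0ₘ⇒preserves-0ₘ F₁-¡≈0ₘ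

  F₁-kernel-mono : ∀ {K X Y} {g : X B.⇒ Y} {k : K B.⇒ X} → B.IsKer g k → Mono A.cat (F₁ k)
  F₁-kernel-mono k-isKer = A.trivial-kernel⇒mono (A.ker-arr≈0ₘ⇒kernel-trivial
    (A.exact-after-0ₘ⇒ker-arr≈0ₘ F₁-¡≈0ₘ (strongExact⇒exact _ _ (B.kernel⇒strongExact k-isKer))))

  split-exact-image⇒cohomology-vanishes : ∀ {X Y Z} {f : X B.⇒ Y} {g : Y B.⇒ Z} →
    g B.∘ f B.≈ B.0ₘ → A.SplitExact (F₁ f) (F₁ g) → CohomologyVanishes (Belian.pre ℬ) f g
  split-exact-image⇒cohomology-vanishes {X} {f = f} {g} gf≈0 split-exact =
    φ , κφ≈ι , B.epi⇒zero-cokernel (faithful-reflects-epi functor faithful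
                                      (A.section⇒epi (F₁ q A.∘ s) (A.≈.trans A.sym-assoc Fφq∘s≈id)))
    where
    φ : im-obj (Belian.pre ℬ) f B.⇒ ker-obj (Belian.pre ℬ) g
    φ = proj₁ (B.image-to-kernel gf≈0)

    κφ≈ι : ker-arr (Belian.pre ℬ) g B.∘ φ B.≈ im-arr (Belian.pre ℬ) f
    κφ≈ι = proj₂ (B.image-to-kernel gf≈0)

    q : X B.⇒ im-obj (Belian.pre ℬ) f
    q = proj₁ (B.im-factor f)

    Fκ∘Fφq≈Ff : F₁ (ker-arr (Belian.pre ℬ) g) A.∘ (F₁ φ A.∘ F₁ q) A.≈ F₁ f
    Fκ∘Fφq≈Ff = A.≈.trans (A.refl⟩∘⟨ A.≈.sym homomorphism)
                  (A.≈.trans (A.≈.sym homomorphism)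
                    (F-resp-≈ (B.≈.trans (B.pullˡ κφ≈ι) (proj₂ (B.im-factor f)))))

    Fφq-split : A.SplitEpi (F₁ φ A.∘ F₁ q)
    Fφq-split = A.SplitExact⇒factor-split-epi split-exact
      (F₁-kernel-mono (B.ker-isKernel g))
      (preserves-0ₘ⇒∘≈0ₘ preserves-0ₘ (proj₁ (B.ker-isKernel g)))
      Fκ∘Fφq≈Ff

    s : F₀ (ker-obj (Belian.pre ℬ) g) A.⇒ F₀ X
    s = proj₁ Fφq-split

    Fφq∘s≈id : (F₁ φ A.∘ F₁ q) A.∘ s A.≈ A.id
    Fφq∘s≈id = proj₂ Fφq-split

  resolution-image-splits : ∀ {i} {member : B.Obj → Set i} {J : B.Obj} →
    (∀ X → member X → Injective A.cat (F₀ X)) → Injective B.cat J →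
    (R : Resolution ℬ member J) →
    ∀ n → A.SplitExact (F₁ (Resolution.d R n)) (F₁ (Resolution.d R (suc n)))
  resolution-image-splits {J = J} member-injective J-injective R n =
    A.exact-injective-complex-splits N δ exact injective (A.retraction⇒mono (F₁ ρ) Fρ∘Fε≈id) (suc n)
    where
    open Resolution R

    ε-mono : Mono B.cat ε
    ε-mono = B.strong∧ker-arr≈0ₘ⇒mono strong-ε
      (B.exact-after-0ₘ⇒ker-arr≈0ₘ (B.from-zero-obj-unique (Belian.𝟘-zero ℬ) _ _) exact-X)

    ρ : I 0 B.⇒ J
    ρ = proj₁ (J-injective ε ε-mono B.id)

    Fρ∘Fε≈id : F₁ ρ A.∘ F₁ ε A.≈ A.id
    Fρ∘Fε≈id = A.≈.trans (A.≈.sym homomorphism)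
                 (A.≈.trans (F-resp-≈ (proj₂ (J-injective ε ε-mono B.id))) identity)

    N : ℕ → A.Obj
    N zero = F₀ J
    N (suc m) = F₀ (I m)

    δ : ∀ m → N m A.⇒ N (suc m)
    δ zero = F₁ ε
    δ (suc m) = F₁ (d m)

    exact : ∀ m → Exact (Abelian.pre 𝒜) (δ m) (δ (suc m))
    exact zero = strongExact⇒exact ε (d 0) (strong-ε , strong-d 0 , exact-0)
    exact (suc m) = strongExact⇒exact (d m) (d (suc m)) (strong-d m , strong-d (suc m) , exact-suc m)

    injective : ∀ m → Injective A.cat (N m)
    injective zero = A.retract-injective (F₁ ε) (F₁ ρ) Fρ∘Fε≈id (member-injective (I 0) (I-member 0))
    injective (suc m) = member-injective (I m) (I-member m)

module AscentDatumProperties {o₁ ℓ₁ e₁ o₂ ℓ₂ e₂ o₃ ℓ₃ e₃ o₄ ℓ₄ e₄ i : Level}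
  {B : Belian o₁ ℓ₁ e₁} {B' : Belian o₂ ℓ₂ e₂} {C : Abelian o₃ ℓ₃ e₃} {C' : Abelian o₄ ℓ₄ e₄}
  {F : Functor (Belian.cat B) (Belian.cat B')} (D : AscentDatum i B B' C C' F) where
  open AscentDatum D
  private
    module A′ = Functor (AscentFunctor.functor A')
    module F = Functor F
    module C′ = PointedProperties (Abelian.pre C')
    module A-properties = AscentFunctorProperties A
    module F̃-properties = PointedFunctorProperties (Abelian.pre C) (Abelian.pre C') F̃

  F-image-resolution-splits : ∀ {J} → Injective (Belian.cat B) J →
    (R : Resolution B (InjectiveClass.member 𝓘) J) → ∀ n →
    C′.SplitExact (A′.F₁ (F.F₁ (Resolution.d R n))) (A′.F₁ (F.F₁ (Resolution.d R (suc n))))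
  F-image-resolution-splits J-injective R n =
    C′.SplitExact-transport
      (α-iso _ (I-member n)) (α-iso _ (I-member (suc n)))
      (C′.iso⇒mono (α-iso _ (I-member (suc (suc n)))))
      (α-natural _ _ (I-member n) (I-member (suc n)) (d n))
      (α-natural _ _ (I-member (suc n)) (I-member (suc (suc n))) (d (suc n)))
      (F̃-properties.preserves-kernels⇒preserves-SplitExact (LeftExact.preservesKernels F̃-leftExact)
        (A-properties.resolution-image-splits A-injective J-injective R n))
    where open Resolution R using (d; I-member)

proposition1p6p9 :
    ∀ {o₁ ℓ₁ e₁ o₂ ℓ₂ e₂ o₃ ℓ₃ e₃ o₄ ℓ₄ e₄ i}
      (B : Belian o₁ ℓ₁ e₁) (B' : Belian o₂ ℓ₂ e₂)
      (C : Abelian o₃ ℓ₃ e₃) (C' : Abelian o₄ ℓ₄ e₄)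
      (F : Functor (Belian.cat B) (Belian.cat B')) →
      LeftStrongExact B B' F →
      (D : AscentDatum i B B' C C' F) →
      (J : Category.Obj (Belian.cat B)) → Injective (Belian.cat B) J →
      (R : Resolution B (InjectiveClass.member (AscentDatum.𝓘 D)) J) →
      (n : ℕ) →
      CohomologyVanishes (Belian.pre B')
        (Functor.F₁ F (Resolution.d R n))
        (Functor.F₁ F (Resolution.d R (suc n)))
proposition1p6p9 B B' C C' F F-lse D J J-injective R n =
  A′-properties.split-exact-image⇒cohomology-vanishes
    (F-properties.preserves-0ₘ⇒∘≈0ₘ
      (F-properties.preserves-kernels⇒preserves-0ₘ (LeftStrongExact.preservesKernels F-lse))
      (B-properties.exact⇒∘≈0ₘ (Resolution.exact-suc R n)))
    (AscentDatumProperties.F-image-resolution-splits D J-injective R n)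
  where
  module B-properties = PointedProperties (Belian.pre B)
  module F-properties = PointedFunctorProperties (Belian.pre B) (Belian.pre B') F
  module A′-properties = AscentFunctorProperties (AscentDatum.A' D)
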